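{- Let $A=\{a(1),\dots,a(r)\}$ be a set of $r$ distinct positive integers with $\sum_{i=1}^{k-1}a(i)<a(k)$ for all $1\le k\le r$, and let $A'$ be the set of sums of nonempty subsets of $A$. For all $\alpha,\beta\in A'$, $v_A(\alpha)>\beta$ if and only if $v_A(\alpha)>z_A(\beta)$.
   Context: The sums of distinct nonempty subsets of $A$ are pairwise distinct, so each $\alpha\in A'$ has a unique defining sum; $v_A(\alpha)$ (resp. $z_A(\alpha)$) is the smallest (resp. largest) element $a(i)$ appearing in the defining sum of $\alpha$. -}

module Defs where

open import Data.Nat using (ℕ; zero; suc; _+_; _≤_)
open import Data.Fin using (Fin; zero; suc)
open import Data.Fin.Subset using (Subset; _∈_)
open import Data.Vec using ([]; _∷_)
open import Data.Bool using (if_then_else_)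
open import Data.Product using (Σ; _×_)
open import Relation.Binary.PropositionalEquality using (_≡_)
open import Function using (_∘_)

-- sumFirst a m = a(0) + ... + a(m-1)  (0-indexed; the paper's a(1)+...+a(m))
sumFirst : ∀ {r} → (Fin r → ℕ) → ℕ → ℕ
sumFirst {zero}  a m       = 0
sumFirst {suc r} a zero    = 0
sumFirst {suc r} a (suc m) = a zero + sumFirst (a ∘ suc) m

subsetSum : ∀ {r} → (Fin r → ℕ) → Subset r → ℕ
subsetSum {zero}  a []      = 0
subsetSum {suc r} a (b ∷ S) = (if b then a zero else 0) + subsetSum (a ∘ suc) S

IsSmallest : ∀ {r} → (Fin r → ℕ) → Subset r → ℕ → Set
IsSmallest {r} a S x = Σ (Fin r) λ i → (i ∈ S) × (x ≡ a i) × (∀ j → j ∈ S → x ≤ a j)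

IsLargest : ∀ {r} → (Fin r → ℕ) → Subset r → ℕ → Set
IsLargest {r} a S x = Σ (Fin r) λ i → (i ∈ S) × (x ≡ a i) × (∀ j → j ∈ S → a j ≤ x)

-- A superincreasing sequence is strictly increasing, and every subset sum of
-- its terms below index i is at most a(0) + … + a(i-1) < a(i).  So if the
-- largest term z of T is below v = a(i), all of T lies below index i and the
-- whole sum of T is below v; the converse holds because z is one of the summands.
module Submission where

open import Defs
open import Data.Nat using (ℕ; _<_; _≤_; zero; suc; z≤n; s≤s)
open import Data.Nat.Properties
open import Data.Fin using (Fin; toℕ; zero; suc)
open import Data.Fin.Properties using (toℕ-injective)
open import Data.Fin.Subset using (Subset; _∈_)
open import Data.Vec using ([]; _∷_; here; there)
open import Data.Bool using (true; false)
open import Data.Product using (_,_)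
open import Data.Sum using (inj₁; inj₂)
open import Data.Empty using (⊥-elim)
open import Relation.Binary.PropositionalEquality using (_≡_; refl; cong; subst)
open import Function using (_∘_)
open import Function.Definitions using (Injective)
open import Function.Bundles using (_⇔_; mk⇔)

Superincreasing : ∀ {r} → (Fin r → ℕ) → Set
Superincreasing a = ∀ k → sumFirst a (toℕ k) < a k

sumFirst-zero : ∀ {r} (a : Fin r → ℕ) → sumFirst a 0 ≡ 0
sumFirst-zero {zero}  a = refl
sumFirst-zero {suc r} a = refl

lookup≤sumFirst : ∀ {r} (a : Fin r → ℕ) i {n} → toℕ i < n → a i ≤ sumFirst a n
lookup≤sumFirst a zero    {suc n} _         = m≤m+n _ _
lookup≤sumFirst a (suc i) {suc n} (s≤s i<n) = ≤-trans (lookup≤sumFirst (a ∘ suc) i i<n) (m≤n+m _ _)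

lookup≤subsetSum : ∀ {r} (a : Fin r → ℕ) {T} m → m ∈ T → a m ≤ subsetSum a T
lookup≤subsetSum a zero    here       = m≤m+n _ _
lookup≤subsetSum a (suc m) (there m∈T) = ≤-trans (lookup≤subsetSum (a ∘ suc) m m∈T) (m≤n+m _ _)

subsetSum≤sumFirst : ∀ {r} (a : Fin r → ℕ) T n →
                     (∀ m → m ∈ T → toℕ m < n) → subsetSum a T ≤ sumFirst a n
subsetSum≤sumFirst a []          n       T<n = z≤n
subsetSum≤sumFirst a (true ∷ T)  zero    T<n with () ← T<n zero here
subsetSum≤sumFirst a (false ∷ T) zero    T<n =
  subst (subsetSum (a ∘ suc) T ≤_) (sumFirst-zero (a ∘ suc))
        (subsetSum≤sumFirst (a ∘ suc) T 0 λ m m∈T → ⊥-elim (n≮0 (T<n (suc m) (there m∈T))))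
subsetSum≤sumFirst a (true ∷ T)  (suc n) T<n =
  +-monoʳ-≤ (a zero) (subsetSum≤sumFirst (a ∘ suc) T n λ m m∈T → ≤-pred (T<n (suc m) (there m∈T)))
subsetSum≤sumFirst a (false ∷ T) (suc n) T<n =
  ≤-trans (subsetSum≤sumFirst (a ∘ suc) T n λ m m∈T → ≤-pred (T<n (suc m) (there m∈T)))
          (m≤n+m _ _)

module _ {r} {a : Fin r → ℕ} (super : Superincreasing a) where

  superincreasing-monotone : ∀ i m → toℕ i ≤ toℕ m → a i ≤ a m
  superincreasing-monotone i m i≤m with m≤n⇒m<n∨m≡n i≤m
  ... | inj₁ i<m = <⇒≤ (≤-<-trans (lookup≤sumFirst a i i<m) (super m))
  ... | inj₂ i≡m = ≤-reflexive (cong a (toℕ-injective i≡m))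

  superincreasing-index-< : ∀ i m → a m < a i → toℕ m < toℕ i
  superincreasing-index-< i m am<ai = ≰⇒> λ i≤m → <⇒≱ am<ai (superincreasing-monotone i m i≤m)

  subsetSum<lookup : ∀ T i → (∀ m → m ∈ T → a m < a i) → subsetSum a T < a i
  subsetSum<lookup T i T<ai =
    ≤-<-trans (subsetSum≤sumFirst a T (toℕ i) λ m m∈T → superincreasing-index-< i m (T<ai m m∈T))
              (super i)

lemma2p1 : (r : ℕ) (a : Fin r → ℕ)
    → (∀ i → 0 < a i)
    → Injective _≡_ _≡_ a
    → (∀ k → sumFirst a (toℕ k) < a k)
    → (S T : Subset r) (v z : ℕ)
    → IsSmallest a S v
    → IsLargest a T z
    → (subsetSum a T < v) ⇔ (z < v)
lemma2p1 r a _ _ super S T v z (i , _ , refl , _) (j , j∈T , refl , zmax) =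
  mk⇔ (≤-<-trans (lookup≤subsetSum a j j∈T))
      (λ z<v → subsetSum<lookup super T i λ m m∈T → ≤-<-trans (zmax m m∈T) z<v)
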